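{- Let $h \geq 1$ be an integer. The set \[ A = \{0\} \cup \left\{ \sum_{j=0}^{i-1} h^j : i = 1, 2, 3, \ldots \right\} \] is an infinite $B_h$-set.
   Context: For an integer $h \geq 1$, a set $A$ of nonnegative integers is a $B_h$-set if every integer $n$ has at most one representation $n = a_{i_1} + a_{i_2} + \cdots + a_{i_h}$ with $a_{i_1}, \ldots, a_{i_h} \in A$ and $a_{i_1} \leq a_{i_2} \leq \cdots \leq a_{i_h}$. -}

module Defs where

open import Data.Nat using (ℕ; zero; suc; _+_; _^_; _≤_; _<_)
open import Data.Fin using (Fin) renaming (_≤_ to _≤ᶠ_)
import Data.Fin as F
open import Data.Product using (Σ; _×_)
open import Data.Sum using (_⊎_)
open import Relation.Binary.PropositionalEquality using (_≡_)

sumFin : ∀ {k} → (Fin k → ℕ) → ℕ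
sumFin {zero} a = 0
sumFin {suc k} a = a F.zero + sumFin (λ i → a (F.suc i))

geomSum : ℕ → ℕ → ℕ
geomSum h zero = 0
geomSum h (suc i) = geomSum h i + h ^ i

IsRep : (A : ℕ → Set) (h : ℕ) (n : ℕ) (a : Fin h → ℕ) → Set
IsRep A h n a =
  ((i : Fin h) → A (a i)) ×
  ((i j : Fin h) → i ≤ᶠ j → a i ≤ a j) ×
  (sumFin a ≡ n)

IsBh : (h : ℕ) → (A : ℕ → Set) → Set
IsBh h A = (n : ℕ) (a b : Fin h → ℕ) →
  IsRep A h n a → IsRep A h n b → (i : Fin h) → a i ≡ b i

-- A set of naturals is infinite iff it is unbounded.
Infinite : (ℕ → Set) → Set
Infinite A = (m : ℕ) → Σ ℕ (λ a → A a × m < a)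

setA : ℕ → ℕ → Set
setA h x = (x ≡ 0) ⊎ Σ ℕ (λ i → (1 ≤ i) × (x ≡ geomSum h i))

{-# OPTIONS --safe #-}
module Submission where

-- Write s k = 1 + h + ⋯ + h^(k-1), so that A is the range of s and h · s p + 1 = s (p + 1).
-- If the largest of m ≤ h elements of A is s p, their sum lies in [s p, m · s p] ⊆ [s p, s (p + 1)),
-- and these windows are disjoint for different p. Hence the sum of a sorted representation
-- determines its largest entry; removing it and recursing determines the rest.

open import Defs
open import Data.Nat using (ℕ; zero; suc; _+_; _*_; _^_; _≤_; _<_; z≤n; s≤s; NonZero)
open import Data.Nat.Properties
open import Data.Nat.Solver using (module +-*-Solver)
open import Data.Fin using (Fin; toℕ; fromℕ; inject₁) renaming (zero to fzero; suc to fsuc; _≤_ to _≤ᶠ_)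
open import Data.Fin.Properties using (toℕ-inject₁; toℕ-fromℕ; toℕ≤pred[n])
open import Data.Vec.Functional using (init; last)
open import Data.Product using (_×_; _,_; ∃; proj₁; proj₂)
open import Data.Sum using (inj₁; inj₂)
open import Function using (_∘_)
open import Relation.Nullary using (contradiction)
open import Relation.Binary using (tri<; tri≈; tri>)
open import Relation.Binary.PropositionalEquality

geomSum-suc-horner : ∀ h k → h * geomSum h k + 1 ≡ geomSum h (suc k)
geomSum-suc-horner h zero = cong (_+ 1) (*-zeroʳ h)
geomSum-suc-horner h (suc k) = begin
  h * (geomSum h k + h ^ k) + 1      ≡⟨ solve 3 (λ h s p → h :* (s :+ p) :+ con 1 := (h :* s :+ con 1) :+ h :* p)
                                              refl h (geomSum h k) (h ^ k) ⟩
  (h * geomSum h k + 1) + h ^ suc k  ≡⟨ cong (_+ h ^ suc k) (geomSum-suc-horner h k) ⟩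
  geomSum h (suc k) + h ^ suc k      ∎
  where open ≡-Reasoning
        open +-*-Solver

geomSum-mono-≤ : ∀ h {k l} → k ≤ l → geomSum h k ≤ geomSum h l
geomSum-mono-≤ h {l = zero} z≤n = ≤-refl
geomSum-mono-≤ h {k} {suc l} k≤1+l with m≤n⇒m<n∨m≡n k≤1+l
... | inj₂ refl = ≤-refl
... | inj₁ (s≤s k≤l) = ≤-trans (geomSum-mono-≤ h k≤l) (m≤m+n (geomSum h l) (h ^ l))

n≤geomSum : ∀ h .{{_ : NonZero h}} k → k ≤ geomSum h k
n≤geomSum h zero = z≤n
n≤geomSum h (suc k) = subst (_≤ geomSum h (suc k)) (+-comm k 1) (+-mono-≤ (n≤geomSum h k) (m^n>0 h k))

geomSum-window-unique : ∀ h {n p q} →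
  geomSum h p ≤ n → n < geomSum h (suc p) →
  geomSum h q ≤ n → n < geomSum h (suc q) → p ≡ q
geomSum-window-unique h {p = p} {q} sp≤n n<sp+1 sq≤n n<sq+1 with <-cmp p q
... | tri≈ _ p≡q _ = p≡q
... | tri< p<q _ _ = contradiction (≤-trans (geomSum-mono-≤ h p<q) sq≤n) (<⇒≱ n<sp+1)
... | tri> _ _ q<p = contradiction (≤-trans (geomSum-mono-≤ h q<p) sp≤n) (<⇒≱ n<sq+1)

sumFin-init-last : ∀ {k} (a : Fin (suc k) → ℕ) → sumFin a ≡ sumFin (init a) + last a
sumFin-init-last {zero} a = +-comm (a fzero) 0
sumFin-init-last {suc k} a = begin
  a fzero + sumFin (a ∘ fsuc)                    ≡⟨ cong (a fzero +_) (sumFin-init-last (a ∘ fsuc)) ⟩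
  a fzero + (sumFin (init (a ∘ fsuc)) + last a)  ≡⟨ +-assoc (a fzero) _ (last a) ⟨
  sumFin (init a) + last a                       ∎
  where open ≡-Reasoning

sumFin-≤ : ∀ {m} (a : Fin m → ℕ) {x} → (∀ i → a i ≤ x) → sumFin a ≤ m * x
sumFin-≤ {zero} a a≤x = z≤n
sumFin-≤ {suc m} a a≤x = +-mono-≤ (a≤x fzero) (sumFin-≤ (a ∘ fsuc) (a≤x ∘ fsuc))

≗-init-last : ∀ {k} {a b : Fin (suc k) → ℕ} →
  (∀ i → init a i ≡ init b i) → last a ≡ last b → ∀ i → a i ≡ b i
≗-init-last {zero} _ a≡b fzero = a≡b
≗-init-last {suc k} init≗ _ fzero = init≗ fzero
≗-init-last {suc k} init≗ last≡ (fsuc i) = ≗-init-last (init≗ ∘ fsuc) last≡ i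

Sorted : ∀ {m} → (Fin m → ℕ) → Set
Sorted {m} a = (i j : Fin m) → i ≤ᶠ j → a i ≤ a j

Sorted-init : ∀ {k} {a : Fin (suc k) → ℕ} → Sorted a → Sorted (init a)
Sorted-init {a = a} sorted i j i≤j =
  sorted (inject₁ i) (inject₁ j) (subst₂ _≤_ (sym (toℕ-inject₁ i)) (sym (toℕ-inject₁ j)) i≤j)

Sorted⇒≤last : ∀ {k} {a : Fin (suc k) → ℕ} → Sorted a → ∀ i → a i ≤ last a
Sorted⇒≤last {k} sorted i =
  sorted i (fromℕ k) (subst (toℕ i ≤_) (sym (toℕ-fromℕ k)) (toℕ≤pred[n] i))

InGeomRange : ℕ → ℕ → Set
InGeomRange h x = ∃ λ k → x ≡ geomSum h k

setA⇒InGeomRange : ∀ {h x} → setA h x → InGeomRange h x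
setA⇒InGeomRange (inj₁ x≡0) = 0 , x≡0
setA⇒InGeomRange (inj₂ (k , _ , x≡sk)) = k , x≡sk

sumFin-∈-geomSum-window : ∀ h {k p} (a : Fin (suc k) → ℕ) → suc k ≤ h → Sorted a →
  last a ≡ geomSum h p → geomSum h p ≤ sumFin a × sumFin a < geomSum h (suc p)
sumFin-∈-geomSum-window h {k} {p} a 1+k≤h sorted last≡sp = lower , upper
  where
  open ≤-Reasoning
  lower : geomSum h p ≤ sumFin a
  lower = begin
    geomSum h p               ≡⟨ last≡sp ⟨
    last a                    ≤⟨ m≤n+m (last a) (sumFin (init a)) ⟩
    sumFin (init a) + last a  ≡⟨ sumFin-init-last a ⟨
    sumFin a                  ∎
  upper : sumFin a < geomSum h (suc p)
  upper = begin-strict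
    sumFin a             ≤⟨ sumFin-≤ a (λ i → subst (a i ≤_) last≡sp (Sorted⇒≤last sorted i)) ⟩
    suc k * geomSum h p  ≤⟨ *-monoˡ-≤ (geomSum h p) 1+k≤h ⟩
    h * geomSum h p      <⟨ m<m+n _ (s≤s z≤n) ⟩
    h * geomSum h p + 1  ≡⟨ geomSum-suc-horner h p ⟩
    geomSum h (suc p)    ∎

sorted-last-determined-by-sum : ∀ h {k} (a b : Fin (suc k) → ℕ) → suc k ≤ h →
  InGeomRange h (last a) → InGeomRange h (last b) → Sorted a → Sorted b →
  sumFin a ≡ sumFin b → last a ≡ last b
sorted-last-determined-by-sum h a b 1+k≤h (p , last-a) (q , last-b) sorted-a sorted-b Σa≡Σb =
  begin
    last a       ≡⟨ last-a ⟩
    geomSum h p  ≡⟨ cong (geomSum h) p≡q ⟩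
    geomSum h q  ≡⟨ last-b ⟨
    last b       ∎
  where
  open ≡-Reasoning
  window-a : geomSum h p ≤ sumFin a × sumFin a < geomSum h (suc p)
  window-a = sumFin-∈-geomSum-window h {p = p} a 1+k≤h sorted-a last-a
  window-b : geomSum h q ≤ sumFin b × sumFin b < geomSum h (suc q)
  window-b = sumFin-∈-geomSum-window h {p = q} b 1+k≤h sorted-b last-b
  p≡q : p ≡ q
  p≡q = geomSum-window-unique h (proj₁ window-a) (proj₂ window-a)
          (subst (geomSum h q ≤_) (sym Σa≡Σb) (proj₁ window-b))
          (subst (_< geomSum h (suc q)) (sym Σa≡Σb) (proj₂ window-b))

sorted-geomSum-tuples-unique : ∀ h {m} (a b : Fin m → ℕ) → m ≤ h →
  (∀ i → InGeomRange h (a i)) → (∀ i → InGeomRange h (b i)) → Sorted a → Sorted b →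
  sumFin a ≡ sumFin b → ∀ i → a i ≡ b i
sorted-geomSum-tuples-unique h {zero} a b _ _ _ _ _ _ ()
sorted-geomSum-tuples-unique h {suc k} a b 1+k≤h a∈ b∈ sorted-a sorted-b Σa≡Σb =
  ≗-init-last init≗ last≡
  where
  last≡ : last a ≡ last b
  last≡ = sorted-last-determined-by-sum h a b 1+k≤h (a∈ (fromℕ k)) (b∈ (fromℕ k)) sorted-a sorted-b Σa≡Σb
  Σinit≡ : sumFin (init a) ≡ sumFin (init b)
  Σinit≡ = +-cancelʳ-≡ (last a) _ _ (begin
    sumFin (init a) + last a  ≡⟨ sumFin-init-last a ⟨
    sumFin a                  ≡⟨ Σa≡Σb ⟩
    sumFin b                  ≡⟨ sumFin-init-last b ⟩
    sumFin (init b) + last b  ≡⟨ cong (sumFin (init b) +_) last≡ ⟨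
    sumFin (init b) + last a  ∎)
    where open ≡-Reasoning
  init≗ : ∀ i → init a i ≡ init b i
  init≗ = sorted-geomSum-tuples-unique h (init a) (init b) (<⇒≤ 1+k≤h)
            (a∈ ∘ inject₁) (b∈ ∘ inject₁) (Sorted-init sorted-a) (Sorted-init sorted-b) Σinit≡

corollary2 : (h : ℕ) → 1 ≤ h → Infinite (setA h) × IsBh h (setA h)
corollary2 h@(suc _) _ = infinite , isBh
  where
  infinite : Infinite (setA h)
  infinite m = geomSum h (suc m) , inj₂ (suc m , s≤s z≤n , refl) , n≤geomSum h (suc m)
  isBh : IsBh h (setA h)
  isBh n a b (a∈A , sorted-a , Σa≡n) (b∈A , sorted-b , Σb≡n) =
    sorted-geomSum-tuples-unique h a b ≤-refl
      (setA⇒InGeomRange ∘ a∈A) (setA⇒InGeomRange ∘ b∈A) sorted-a sorted-b (trans Σa≡n (sym Σb≡n))
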